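{- Let $s,t\in\mathcal{M}$, $C\subseteq\mathcal{M}$ and $\sigma$ a request sequence. Then (a) $\mathrm{Sl}_\sigma(t;C)\geq\mathrm{Sl}_\sigma(s;C)-(1+\lambda)d(s,t)$, and (b) if $t$ dominates $s$ with respect to $\sigma$, then $\mathrm{Sl}_\sigma(t;C)\geq\mathrm{Sl}_\sigma(s;C)+(1-\lambda)d(s,t)$.
   Context: A metrical service system consists of a metric space $(\mathcal{M},d)$, an origin $\mathcal{O}\in\mathcal{M}$, and requests that are subsets of $\mathcal{M}$. For a request sequence $\sigma=r_1,\dots,r_n$ the work function $W_\sigma(s)$ is the minimum of $d(\mathcal{O},s_1)+\sum_{i=1}^{n-1}d(s_i,s_{i+1})+d(s_n,s)$ over $s_i\in r_i$ (assumed attained). A point $s$ is dominated by a point $t$ with respect to $\sigma$ if $W_\sigma(s)=W_\sigma(t)+d(s,t)$. Fix $\lambda\in(0,1)$. For $s\in\mathcal{M}$ and $C\subseteq\mathcal{M}$ the slack is $\mathrm{Sl}_\sigma(s;C)=\min_{u\in C}\{W_\sigma(u)+\lambda d(u,s)\}-W_\sigma(s)$ (minima assumed attained). -}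

module Defs where

open import Level using (0ℓ)
open import Algebra.Bundles using (CommutativeRing)
open import Data.Product using (Σ; ∃; _×_; _,_)
open import Data.Sum using (_⊎_)
open import Data.List using (List; []; _∷_)
open import Data.List.Relation.Unary.All using (All; []; _∷_)
open import Relation.Nullary using (¬_)
open import Data.Unit using (⊤)
open import Relation.Binary.PropositionalEquality using (_≡_)

-- The real numbers, axiomatised as a complete ordered field
-- (any two such structures are isomorphic, so quantifying over them
-- is the same as working with ℝ).

record Reals : Set₁ where
  field
    commRing : CommutativeRing 0ℓ 0ℓ
  open CommutativeRing commRing public
  field
    _≤_       : Carrier → Carrier → Set
    ≤-resp-≈  : ∀ {a b c d} → a ≈ b → c ≈ d → a ≤ c → b ≤ d
    ≤-refl    : ∀ {a} → a ≤ a
    ≤-trans   : ∀ {a b c} → a ≤ b → b ≤ c → a ≤ c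
    ≤-antisym : ∀ {a b} → a ≤ b → b ≤ a → a ≈ b
    ≤-total   : ∀ a b → (a ≤ b) ⊎ (b ≤ a)
    +-mono-≤  : ∀ {a b} c → a ≤ b → (a + c) ≤ (b + c)
    *-nonneg  : ∀ {a b} → 0# ≤ a → 0# ≤ b → 0# ≤ (a * b)
    0≉1       : ¬ (0# ≈ 1#)
    inverse   : ∀ a → ¬ (a ≈ 0#) → Σ Carrier (λ b → (a * b) ≈ 1#)
    complete  : (P : Carrier → Set) → Σ Carrier P →
                Σ Carrier (λ b → ∀ x → P x → x ≤ b) →
                Σ Carrier (λ s → (∀ x → P x → x ≤ s) ×
                                 (∀ b → (∀ x → P x → x ≤ b) → s ≤ b))

  _<_ : Carrier → Carrier → Set
  a < b = (a ≤ b) × ¬ (a ≈ b)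

  _≥_ : Carrier → Carrier → Set
  a ≥ b = b ≤ a

record MetricSpace (R : Reals) : Set₁ where
  open Reals R
  field
    Point    : Set
    d        : Point → Point → Carrier
    d-nonneg : ∀ x y → 0# ≤ d x y
    d-zero   : ∀ x y → d x y ≈ 0# → x ≡ y
    d-refl   : ∀ x → d x x ≈ 0#
    d-sym    : ∀ x y → d x y ≈ d y x
    d-tri    : ∀ x y z → d x z ≤ (d x y + d y z)

module MSS {R : Reals} (X : MetricSpace R) (O : MetricSpace.Point X) where
  open Reals R
  open MetricSpace X

  Request : Set₁
  Request = Point → Set

  RequestSeq : Set₁
  RequestSeq = List Request

  Service : RequestSeq → Set₁
  Service σ = All (λ r → Σ Point r) σ

  costFrom : ∀ {σ} → Point → Service σ → Point → Carrier
  costFrom x []              s = d x s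
  costFrom x ((y , _) ∷ ps)  s = d x y + costFrom y ps s

  IsMinOver : ∀ {a} {A : Set a} → (A → Set) → (A → Carrier) → Carrier → Set a
  IsMinOver {A = A} P f m = Σ A (λ a → P a × (f a ≈ m)) × (∀ a → P a → m ≤ f a)

  -- W is the work function of σ (the minimum is assumed attained)
  IsWorkFunction : RequestSeq → (Point → Carrier) → Set₁
  IsWorkFunction σ W = ∀ s → IsMinOver {A = Service σ} (λ _ → ⊤) (λ p → costFrom O p s) (W s)

  Dominated : (Point → Carrier) → Point → Point → Set
  Dominated W s t = W s ≈ (W t + d s t)

  -- Sl_σ(s;C) = min_{u∈C} {W(u) + λ d(u,s)} − W(s), where the minimum
  -- (assumed attained) is the value m
  SlackMin : Carrier → (Point → Carrier) → Request → Point → Carrier → Set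
  SlackMin lam W C s m = IsMinOver C (λ u → W u + lam * d u s) m

  Sl : (Point → Carrier) → Point → Carrier → Carrier
  Sl W s m = m - W s

-- The map u ↦ W(u) + λ d(u,s) moves by at most λ d(s,t) when s is replaced
-- by t, so min_{u∈C} {W(u) + λ d(u,s)} is λ-Lipschitz in s, while the work
-- function itself is 1-Lipschitz; together this gives (a).  If t dominates s,
-- then W(t) = W(s) − d(s,t) exactly, and the loss of at most λ d(s,t) in the
-- minimum is outweighed by the gain of d(s,t) in −W, which gives (b).
module Submission where

open import Defs
open import Level using (0ℓ)
open import Data.Product using (_×_; _,_; proj₂)
open import Data.List.Relation.Unary.All using ([]; _∷_)
open import Data.Unit using (tt)
open import Relation.Binary.Bundles using (Poset)
import Algebra.Solver.CommutativeMonoid as CommutativeMonoidSolver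
import Algebra.Properties.AbelianGroup as AbelianGroupProperties
import Algebra.Properties.Ring as RingProperties
import Relation.Binary.Reasoning.PartialOrder as PosetReasoning

module RealsProperties (R : Reals) where
  open Reals R
  open RingProperties ring using ([y-z]x≈yx-zx; x[y-z]≈xy-xz)
  open AbelianGroupProperties +-abelianGroup
    using (\\-leftDividesˡ; //-rightDividesˡ; //-rightDividesʳ; ⁻¹-∙-comm; ⁻¹-anti-homo‿-)
  open CommutativeMonoidSolver +-commutativeMonoid using (solve; _⊜_; _⊕_)

  poset : Poset 0ℓ 0ℓ 0ℓ
  poset = record
    { Carrier = Carrier
    ; _≈_ = _≈_
    ; _≤_ = _≤_
    ; isPartialOrder = record
      { isPreorder = record
        { isEquivalence = isEquivalence
        ; reflexive = λ a≈b → ≤-resp-≈ refl a≈b ≤-refl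
        ; trans = ≤-trans
        }
      ; antisym = ≤-antisym
      }
    }

  open PosetReasoning poset public

  +-monoʳ-≤ : ∀ {a b} c → a ≤ b → (c + a) ≤ (c + b)
  +-monoʳ-≤ {a} {b} c a≤b = ≤-resp-≈ (+-comm a c) (+-comm b c) (+-mono-≤ c a≤b)

  +-mono₂-≤ : ∀ {a b c e} → a ≤ b → c ≤ e → (a + c) ≤ (b + e)
  +-mono₂-≤ {b = b} {c = c} a≤b c≤e = ≤-trans (+-mono-≤ c a≤b) (+-monoʳ-≤ b c≤e)

  -‿antimono-≤ : ∀ {x y} → x ≤ y → (- y) ≤ (- x)
  -‿antimono-≤ {x} {y} x≤y = ≤-resp-≈ (\\-leftDividesˡ x (- y)) y-x-y≈-x (+-mono-≤ (- x + - y) x≤y)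
    where
    y-x-y≈-x : y + (- x + - y) ≈ - x
    y-x-y≈-x = trans (+-cong refl (+-comm (- x) (- y))) (\\-leftDividesˡ y (- x))

  x≤y+z⇒x-z≤y : ∀ {x y z} → x ≤ (y + z) → (x - z) ≤ y
  x≤y+z⇒x-z≤y {x} {y} {z} x≤y+z = ≤-resp-≈ refl (//-rightDividesʳ z y) (+-mono-≤ (- z) x≤y+z)

  *-monoˡ-≤-nonNeg : ∀ {c a b} → 0# ≤ c → a ≤ b → (c * a) ≤ (c * b)
  *-monoˡ-≤-nonNeg {c} {a} {b} 0≤c a≤b = begin
    c * a                    ≈⟨ sym (+-identityˡ (c * a)) ⟩
    0# + c * a               ≤⟨ +-mono-≤ (c * a) (*-nonneg 0≤c 0≤b-a) ⟩
    c * (b - a) + c * a      ≈⟨ +-cong (x[y-z]≈xy-xz c b a) refl ⟩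
    (c * b - c * a) + c * a  ≈⟨ //-rightDividesˡ (c * a) (c * b) ⟩
    c * b                    ∎
    where
    0≤b-a : 0# ≤ (b - a)
    0≤b-a = ≤-resp-≈ (-‿inverseʳ a) refl (+-mono-≤ (- a) a≤b)

  [1+λ]x≈x+λx : ∀ λ′ x → (1# + λ′) * x ≈ x + λ′ * x
  [1+λ]x≈x+λx λ′ x = trans (distribʳ x 1# λ′) (+-cong (*-identityˡ x) refl)

  [1-λ]x≈x-λx : ∀ λ′ x → (1# - λ′) * x ≈ x - λ′ * x
  [1-λ]x≈x-λx λ′ x = trans ([y-z]x≈yx-zx x 1# λ′) (+-cong (*-identityˡ x) refl)

  x≈y+z⇒x-z≈y : ∀ {x y z} → x ≈ y + z → x - z ≈ y
  x≈y+z⇒x-z≈y {y = y} {z = z} x≈y+z = trans (+-cong x≈y+z refl) (//-rightDividesʳ z y)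

  x-y-[z+w]≈x-w-[y+z] : ∀ x y z w → (x - y) - (z + w) ≈ (x - w) - (y + z)
  x-y-[z+w]≈x-w-[y+z] x y z w = begin-equality
    (x - y) - (z + w)      ≈⟨ +-cong refl (sym (⁻¹-∙-comm z w)) ⟩
    (x - y) + (- z + - w)  ≈⟨ solve 4 (λ x -y -z -w → (x ⊕ -y) ⊕ (-z ⊕ -w) ⊜ (x ⊕ -w) ⊕ (-y ⊕ -z)) refl x (- y) (- z) (- w) ⟩
    (x - w) + (- y + - z)  ≈⟨ +-cong refl (⁻¹-∙-comm y z) ⟩
    (x - w) - (y + z)      ∎

  x-y+[z-w]≈x-w-[y-z] : ∀ x y z w → (x - y) + (z - w) ≈ (x - w) - (y - z)
  x-y+[z-w]≈x-w-[y-z] x y z w = begin-equality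
    (x - y) + (z - w)  ≈⟨ solve 4 (λ x -y z -w → (x ⊕ -y) ⊕ (z ⊕ -w) ⊜ (x ⊕ -w) ⊕ (z ⊕ -y)) refl x (- y) z (- w) ⟩
    (x - w) + (z - y)  ≈⟨ +-cong refl (sym (⁻¹-anti-homo‿- y z)) ⟩
    (x - w) - (y - z)  ∎

module SlackProperties (R : Reals) (X : MetricSpace R) (O : MetricSpace.Point X) where
  open Reals R
  open RealsProperties R
  open MetricSpace X
  open MSS X O

  costFrom-lipschitz : ∀ {σ} x (p : Service σ) s t → costFrom x p t ≤ (costFrom x p s + d s t)
  costFrom-lipschitz x []              s t = d-tri x s t
  costFrom-lipschitz x ((y , _) ∷ ps)  s t =
    ≤-resp-≈ refl (sym (+-assoc (d x y) (costFrom y ps s) (d s t)))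
      (+-monoʳ-≤ (d x y) (costFrom-lipschitz y ps s t))

  workFunction-lipschitz : ∀ {σ W} → IsWorkFunction σ W → ∀ s t → W t ≤ (W s + d s t)
  workFunction-lipschitz {W = W} isWF s t with isWF s
  ... | (p , _ , cost≈Ws) , _ = begin
    W t                        ≤⟨ proj₂ (isWF t) p tt ⟩
    costFrom O p t             ≤⟨ costFrom-lipschitz O p s t ⟩
    costFrom O p s + d s t     ≈⟨ +-cong cost≈Ws refl ⟩
    W s + d s t                ∎

  slackMin-lipschitz : ∀ {lam W C s t ms mt} → 0# ≤ lam →
                       SlackMin lam W C s ms → SlackMin lam W C t mt →
                       ms ≤ (mt + lam * d s t)
  slackMin-lipschitz {lam} {W} {s = s} {t} {ms} {mt} 0≤lam (_ , ms-minimal) ((u , u∈C , mt≈) , _) =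
    begin
      ms                                   ≤⟨ ms-minimal u u∈C ⟩
      W u + lam * d u s                    ≤⟨ +-monoʳ-≤ (W u) (*-monoˡ-≤-nonNeg 0≤lam (d-tri u t s)) ⟩
      W u + lam * (d u t + d t s)          ≈⟨ +-cong refl (distribˡ lam (d u t) (d t s)) ⟩
      W u + (lam * d u t + lam * d t s)    ≈⟨ sym (+-assoc (W u) (lam * d u t) (lam * d t s)) ⟩
      (W u + lam * d u t) + lam * d t s    ≈⟨ +-cong mt≈ (*-cong refl (d-sym t s)) ⟩
      mt + lam * d s t                     ∎

  slack-lipschitz : ∀ {lam σ W C s t ms mt} → 0# ≤ lam → IsWorkFunction σ W →
                    SlackMin lam W C s ms → SlackMin lam W C t mt →
                    Sl W t mt ≥ (Sl W s ms - (1# + lam) * d s t)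
  slack-lipschitz {lam} {W = W} {s = s} {t} {ms} {mt} 0≤lam isWF sMin tMin = begin
    (ms - W s) - (1# + lam) * d s t     ≈⟨ +-cong refl (-‿cong ([1+λ]x≈x+λx lam (d s t))) ⟩
    (ms - W s) - (d s t + lam * d s t)  ≈⟨ x-y-[z+w]≈x-w-[y+z] ms (W s) (d s t) (lam * d s t) ⟩
    (ms - lam * d s t) - (W s + d s t)  ≤⟨ +-mono₂-≤ (x≤y+z⇒x-z≤y (slackMin-lipschitz 0≤lam sMin tMin))
                                                      (-‿antimono-≤ (workFunction-lipschitz isWF s t)) ⟩
    mt - W t                            ∎

  slack-dominated : ∀ {lam W C s t ms mt} → 0# ≤ lam → Dominated W s t →
                    SlackMin lam W C s ms → SlackMin lam W C t mt →
                    Sl W t mt ≥ (Sl W s ms + (1# - lam) * d s t)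
  slack-dominated {lam} {W} {s = s} {t} {ms} {mt} 0≤lam s≺t sMin tMin = begin
    (ms - W s) + (1# - lam) * d s t     ≈⟨ +-cong refl ([1-λ]x≈x-λx lam (d s t)) ⟩
    (ms - W s) + (d s t - lam * d s t)  ≈⟨ x-y+[z-w]≈x-w-[y-z] ms (W s) (d s t) (lam * d s t) ⟩
    (ms - lam * d s t) - (W s - d s t)  ≈⟨ +-cong refl (-‿cong (x≈y+z⇒x-z≈y s≺t)) ⟩
    (ms - lam * d s t) - W t            ≤⟨ +-mono-≤ (- W t) (x≤y+z⇒x-z≤y (slackMin-lipschitz 0≤lam sMin tMin)) ⟩
    mt - W t                            ∎

-- Both inequalities hold for every λ ≥ 0.
lemma6 : (R : Reals) → (X : MetricSpace R) → (O : MetricSpace.Point X) →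
         let open Reals R in let open MetricSpace X in let open MSS X O in
         (lam : Carrier) → 0# < lam → lam < 1# →
         (σ : RequestSeq) (W : Point → Carrier) → IsWorkFunction σ W →
         (C : Request) (s t : Point) (ms mt : Carrier) →
         SlackMin lam W C s ms → SlackMin lam W C t mt →
         (Sl W t mt ≥ (Sl W s ms - (1# + lam) * d s t)) ×
         (Dominated W s t → Sl W t mt ≥ (Sl W s ms + (1# - lam) * d s t))
lemma6 R X O lam (0≤lam , _) _ σ W isWF C s t ms mt sMin tMin =
  slack-lipschitz 0≤lam isWF sMin tMin , λ s≺t → slack-dominated 0≤lam s≺t sMin tMin
  where open SlackProperties R X O
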